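{- Let $n,r\geq 2$ be integers, let $G=C_n^r$, and let $k\in[0,n-1]$ be an integer. Then $$\mathsf{s}_{\leq 2n-1-k}(G)\geq 2^{r-1}(n-1)+1+k.$$
   Context: All groups are finite abelian, written additively; $C_n$ is the cyclic group of order $n$. A sequence over $G$ is a finite unordered sequence (multiset) of elements of $G$; its length $|S|$ is the number of terms counted with multiplicity; a subsequence is a sub-multiset; $S$ is zero-sum if the sum of its terms is $0$. For $k\in\mathbb{N}$, $\mathsf{s}_{\leq k}(G)$ denotes the smallest $\ell\in\mathbb{N}\cup\{+\infty\}$ such that every sequence over $G$ of length $\ell$ has a nonempty zero-sum subsequence of length at most $k$. -}

module Defs where

open import Data.Nat using (ℕ; _<_; _≤_)
open import Data.Nat.Divisibility using (_∣_)
open import Data.Fin using (Fin; toℕ)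
open import Data.List using (List; length; map)
open import Data.Nat.ListAction using (sum)
open import Data.List.Relation.Binary.Sublist.Propositional using (_⊆_)
open import Data.Product using (Σ; _×_)
open import Relation.Binary.PropositionalEquality using (_≡_)

-- The group C_n^r: an element is an r-tuple of residues mod n
-- (represented by Fin n); addition is coordinatewise mod n.
Cnr : ℕ → ℕ → Set
Cnr n r = Fin r → Fin n

-- A sequence (finite multiset) over C_n^r, represented as a list
-- (order is irrelevant for everything below).
Seq : ℕ → ℕ → Set
Seq n r = List (Cnr n r)

IsZeroSum : ∀ {n r} → Seq n r → Set
IsZeroSum {n} {r} S = (i : Fin r) → n ∣ sum (map (λ g → toℕ (g i)) S)

HasShortZeroSum : ∀ {n r} → ℕ → Seq n r → Set
HasShortZeroSum {n} {r} k S =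
  Σ (Seq n r) λ T → (T ⊆ S) × (0 < length T) × (length T ≤ k) × IsZeroSum T

Admissible : ℕ → ℕ → ℕ → ℕ → Set
Admissible n r k ℓ = (S : Seq n r) → length S ≡ ℓ → HasShortZeroSum k S

-- s_{≤k}(C_n^r) ≥ L  (s being the least admissible ℓ, or +∞ if none):
-- every admissible ℓ is at least L.
sLeqGeq : ℕ → ℕ → ℕ → ℕ → Set
sLeqGeq n r k L = (ℓ : ℕ) → Admissible n r k ℓ → L ≤ ℓ

-- Let n ≥ 2 and let Cₘ be the sequence over C_n^m in which every 0/1-vector occurs n − 1 times.
-- Cₘ has no zero-sum subsequence of length exactly n: in C_{m+1} = (0, Cₘ)(1, Cₘ) the first
-- coordinate of such a subsequence sums to the number of its terms from the second half, which
-- must therefore be 0 or n, so the subsequence lies in a single copy of Cₘ.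
-- Over C_n^{m+2} take k copies of (1, 1, 0) together with all (1, 0, x) and (0, 1, x), x in Cₘ;
-- this has length 2^{m+1}(n − 1) + k.  A nonempty zero-sum subsequence of length at most
-- 2n − 1 − k with j terms (1, 1, 0), p terms (1, 0, x) and q terms (0, 1, x) has n ∣ j + p and
-- n ∣ j + q, both below 2n.  Both equal to n would give 2n = 2j + p + q ≤ (j + p + q) + k < 2n,
-- so j = 0 and {p, q} = {0, n}, leaving a zero-sum subsequence of Cₘ of length n.
module Submission where

open import Defs
open import Data.Nat using (ℕ; zero; suc; _≤_; _<_; _+_; _*_; _∸_; _^_; z≤n; s≤s; z<s)
open import Data.Nat.Properties
open import Data.Nat.Divisibility using (_∣_; divides)
open import Data.Nat.ListAction using (sum)
open import Data.Nat.ListAction.Properties using (sum-++)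
open import Data.Nat.Tactic.RingSolver using (solve-∀)
open import Data.Fin using (Fin; toℕ; zero; suc)
open import Data.Vec.Functional using () renaming ([] to []ᵛ; _∷_ to _∷ᵛ_)
open import Data.List using (List; []; _∷_; _++_; length; map; replicate; take)
open import Data.List.Properties
  using (map-++; map-∘; length-++; length-map; length-replicate; length-take; ++-identityʳ)
open import Data.List.Relation.Binary.Sublist.Propositional using (_⊆_; []; _∷_; _∷ʳ_; ⊆-trans)
open import Data.List.Relation.Binary.Sublist.Propositional.Properties using (take-⊆; length-mono-≤)
open import Data.Product using (Σ; ∃; ∃₂; _×_; _,_; proj₁; proj₂)
open import Data.Sum using (_⊎_; inj₁; inj₂)
open import Relation.Nullary using (¬_; contradiction)
open import Relation.Binary.PropositionalEquality
  using (_≡_; refl; sym; trans; ≢-sym; cong; cong₂; subst; module ≡-Reasoning)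

private
  variable
    A B : Set
    a m n r k K ℓ : ℕ

coordSum : Fin r → Seq n r → ℕ
coordSum i S = sum (map (λ g → toℕ (g i)) S)

coordSum-++ : (i : Fin r) (S T : Seq n r) → coordSum i (S ++ T) ≡ coordSum i S + coordSum i T
coordSum-++ i S T = trans (cong sum (map-++ _ S T)) (sum-++ (map _ S) _)

coordSum-map : (f : A → Cnr n r) (i : Fin r) (X : List A) →
  coordSum i (map f X) ≡ sum (map (λ x → toℕ (f x i)) X)
coordSum-map f i X = cong sum (sym (map-∘ X))

coordSum-replicate : (i : Fin r) (j : ℕ) (g : Cnr n r) → coordSum i (replicate j g) ≡ j * toℕ (g i)
coordSum-replicate i zero    g = refl
coordSum-replicate i (suc j) g = cong (toℕ (g i) +_) (coordSum-replicate i j g)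

sum-map-const : (c : ℕ) (X : List A) → sum (map (λ _ → c) X) ≡ length X * c
sum-map-const c []      = refl
sum-map-const c (_ ∷ X) = cong (c +_) (sum-map-const c X)

⊆-++⁻ : (xs : List A) {ys T : List A} → T ⊆ xs ++ ys →
  ∃₂ λ T₁ T₂ → T₁ ⊆ xs × T₂ ⊆ ys × T ≡ T₁ ++ T₂
⊆-++⁻ []       T⊆ = [] , _ , [] , T⊆ , refl
⊆-++⁻ (x ∷ xs) (.x ∷ʳ T⊆) with ⊆-++⁻ xs T⊆
... | T₁ , T₂ , T₁⊆ , T₂⊆ , refl = T₁ , T₂ , x ∷ʳ T₁⊆ , T₂⊆ , refl
⊆-++⁻ (x ∷ xs) (refl ∷ T⊆) with ⊆-++⁻ xs T⊆
... | T₁ , T₂ , T₁⊆ , T₂⊆ , refl = x ∷ T₁ , T₂ , refl ∷ T₁⊆ , T₂⊆ , refl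

⊆-map⁻ : (f : A → B) (xs : List A) {T : List B} → T ⊆ map f xs → ∃ λ Y → Y ⊆ xs × T ≡ map f Y
⊆-map⁻ f []       [] = [] , [] , refl
⊆-map⁻ f (x ∷ xs) (_ ∷ʳ T⊆) with ⊆-map⁻ f xs T⊆
... | Y , Y⊆ , refl = Y , x ∷ʳ Y⊆ , refl
⊆-map⁻ f (x ∷ xs) (refl ∷ T⊆) with ⊆-map⁻ f xs T⊆
... | Y , Y⊆ , refl = x ∷ Y , refl ∷ Y⊆ , refl

⊆-replicate⁻ : (k : ℕ) (x : A) {T : List A} → T ⊆ replicate k x → ∃ λ j → j ≤ k × T ≡ replicate j x
⊆-replicate⁻ zero    x [] = 0 , z≤n , refl
⊆-replicate⁻ (suc k) x (_ ∷ʳ T⊆) with ⊆-replicate⁻ k x T⊆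
... | j , j≤k , refl = j , m≤n⇒m≤1+n j≤k , refl
⊆-replicate⁻ (suc k) x (refl ∷ T⊆) with ⊆-replicate⁻ k x T⊆
... | j , j≤k , refl = suc j , s≤s j≤k , refl

⊆-map-++-map⁻ : (f g : A → B) (X X′ : List A) {T : List B} → T ⊆ map f X ++ map g X′ →
  ∃₂ λ Y Z → Y ⊆ X × Z ⊆ X′ × T ≡ map f Y ++ map g Z
⊆-map-++-map⁻ f g X X′ T⊆ with ⊆-++⁻ (map f X) T⊆
... | T₁ , T₂ , T₁⊆ , T₂⊆ , refl with ⊆-map⁻ f X T₁⊆ | ⊆-map⁻ g X′ T₂⊆
... | Y , Y⊆ , refl | Z , Z⊆ , refl = Y , Z , Y⊆ , Z⊆ , refl

HasZeroSumOfLength : ℕ → Seq n r → Set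
HasZeroSumOfLength {n} {r} ℓ S = Σ (Seq n r) λ T → T ⊆ S × length T ≡ ℓ × IsZeroSum T

short⇒¬hasZeroSumOfLength : {S : Seq n r} → length S < ℓ → ¬ HasZeroSumOfLength ℓ S
short⇒¬hasZeroSumOfLength |S|<ℓ (T , T⊆S , refl , _) = <⇒≱ |S|<ℓ (length-mono-≤ T⊆S)

OneIsZeroOtherIs : ℕ → ℕ → ℕ → Set
OneIsZeroOtherIs n p q = (p ≡ 0 × q ≡ n) ⊎ (p ≡ n × q ≡ 0)

halves⇒hasZeroSumOfLength : {X Y Z : Seq n r} → Y ⊆ X → Z ⊆ X →
  OneIsZeroOtherIs ℓ (length Y) (length Z) → IsZeroSum (Y ++ Z) → HasZeroSumOfLength ℓ X
halves⇒hasZeroSumOfLength {Y = []}    _   Z⊆X (inj₁ (_ , |Z|≡ℓ)) Z-zs = _ , Z⊆X , |Z|≡ℓ , Z-zs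
halves⇒hasZeroSumOfLength {Y = _ ∷ _} _   _   (inj₁ (() , _))     _
halves⇒hasZeroSumOfLength {Y = Y} {Z = []} Y⊆X _ (inj₂ (|Y|≡ℓ , _)) Y-zs =
  Y , Y⊆X , |Y|≡ℓ , subst IsZeroSum (++-identityʳ Y) Y-zs
halves⇒hasZeroSumOfLength {Z = _ ∷ _} _   _   (inj₂ (_ , ()))     _

m∣n∧n<2m⇒n≡0∨n≡m : ∀ {m n} → m ∣ n → n < 2 * m → n ≡ 0 ⊎ n ≡ m
m∣n∧n<2m⇒n≡0∨n≡m       (divides zero refl)          _    = inj₁ refl
m∣n∧n<2m⇒n≡0∨n≡m {m}   (divides (suc zero) refl)    _    = inj₂ (+-identityʳ m)
m∣n∧n<2m⇒n≡0∨n≡m {m}   (divides (suc (suc q)) refl) n<2m =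
  contradiction (*-monoˡ-≤ m {2} {suc (suc q)} (s≤s (s≤s z≤n))) (<⇒≱ n<2m)

n∣q∧p+q≡n⇒oneIsZeroOtherIs : ∀ {n p q} → n ∣ q → p + q ≡ n → OneIsZeroOtherIs n p q
n∣q∧p+q≡n⇒oneIsZeroOtherIs {zero}  {p} _   p+q≡0 = inj₁ (m+n≡0⇒m≡0 p p+q≡0 , m+n≡0⇒n≡0 p p+q≡0)
n∣q∧p+q≡n⇒oneIsZeroOtherIs {suc n} {p} {q} n∣q p+q≡n
  with m∣n∧n<2m⇒n≡0∨n≡m n∣q (≤-<-trans q≤n (m<m+n (suc n) z<s))
  where
  q≤n : q ≤ suc n
  q≤n = subst (q ≤_) p+q≡n (m≤n+m q p)
... | inj₁ refl = inj₂ (trans (sym (+-identityʳ p)) p+q≡n , refl)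
... | inj₂ refl = inj₁ (+-cancelʳ-≡ (suc n) p 0 p+q≡n , refl)

n∣j+p∧n∣j+q∧short⇒j≡0∧oneIsZeroOtherIs : ∀ {n j p q k} → n ∣ j + p → n ∣ j + q → j ≤ k →
  j + (p + q) + k < 2 * n → 0 < j + (p + q) → j ≡ 0 × OneIsZeroOtherIs n p q
n∣j+p∧n∣j+q∧short⇒j≡0∧oneIsZeroOtherIs {n} {j} {p} {q} {k} n∣j+p n∣j+q j≤k bound 0<j+p+q
  with m∣n∧n<2m⇒n≡0∨n≡m n∣j+p (≤-<-trans (j+p≤ p q) bound)
     | m∣n∧n<2m⇒n≡0∨n≡m n∣j+q (≤-<-trans (j+p≤ q p) (subst (λ s → j + s + k < 2 * n) (+-comm p q) bound))
  where
  j+p≤ : ∀ p q → j + p ≤ j + (p + q) + k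
  j+p≤ p q = ≤-trans (+-monoʳ-≤ j (m≤m+n p q)) (m≤m+n _ k)
... | inj₁ j+p≡0 | inj₁ j+q≡0 =
  contradiction (cong₂ _+_ (m+n≡0⇒m≡0 j j+p≡0) (cong₂ _+_ (m+n≡0⇒n≡0 j j+p≡0) (m+n≡0⇒n≡0 j j+q≡0)))
                (≢-sym (<⇒≢ 0<j+p+q))
... | inj₁ j+p≡0 | inj₂ j+q≡n =
  j≡0 , inj₁ (m+n≡0⇒n≡0 j j+p≡0 , trans (cong (_+ q) (sym j≡0)) j+q≡n)
  where
  j≡0 : j ≡ 0
  j≡0 = m+n≡0⇒m≡0 j j+p≡0
... | inj₂ j+p≡n | inj₁ j+q≡0 =
  j≡0 , inj₂ (trans (cong (_+ p) (sym j≡0)) j+p≡n , m+n≡0⇒n≡0 j j+q≡0)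
  where
  j≡0 : j ≡ 0
  j≡0 = m+n≡0⇒m≡0 j j+q≡0
... | inj₂ j+p≡n | inj₂ j+q≡n = contradiction 2n<2n (<-irrefl refl)
  where
  open ≤-Reasoning
  regroup : ∀ j p q → j + p + (j + q + 0) ≡ j + (p + q) + j
  regroup = solve-∀
  2n<2n : 2 * n < 2 * n
  2n<2n = begin-strict
    2 * n                  ≡⟨ cong₂ (λ u v → u + (v + 0)) (sym j+p≡n) (sym j+q≡n) ⟩
    j + p + (j + q + 0)    ≡⟨ regroup j p q ⟩
    j + (p + q) + j        ≤⟨ +-monoʳ-≤ (j + (p + q)) j≤k ⟩
    j + (p + q) + k        <⟨ bound ⟩
    2 * n                  ∎

⊆-replicate-++-map-++-map⁻ : (k : ℕ) (x : B) (f g : A → B) (X : List A) {T : List B} →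
  T ⊆ replicate k x ++ (map f X ++ map g X) →
  ∃ λ j → ∃₂ λ Y Z → j ≤ k × Y ⊆ X × Z ⊆ X × T ≡ replicate j x ++ (map f Y ++ map g Z)
⊆-replicate-++-map-++-map⁻ k x f g X T⊆ with ⊆-++⁻ (replicate k x) T⊆
... | T₁ , T₂ , T₁⊆ , T₂⊆ , refl with ⊆-replicate⁻ k x T₁⊆ | ⊆-map-++-map⁻ f g X X T₂⊆
... | j , j≤k , refl | Y , Z , Y⊆X , Z⊆X , refl = j , Y , Z , j≤k , Y⊆X , Z⊆X , refl

coordSum-map-++-map : (f g : A → Cnr n r) (i : Fin r) (Y Z : List A) →
  coordSum i (map f Y ++ map g Z) ≡ sum (map (λ y → toℕ (f y i)) Y) + sum (map (λ z → toℕ (g z i)) Z)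
coordSum-map-++-map f g i Y Z =
  trans (coordSum-++ i (map f Y) _) (cong₂ _+_ (coordSum-map f i Y) (coordSum-map g i Z))

length-map-++-map : (f g : A → B) (X Y : List A) → length (map f X ++ map g Y) ≡ length X + length Y
length-map-++-map f g X Y = trans (length-++ (map f X)) (cong₂ _+_ (length-map f X) (length-map g Y))

0F 1F : Fin (2 + a)
0F = zero
1F = suc zero

doubled : Seq (2 + a) m → Seq (2 + a) m → Seq (2 + a) (suc m)
doubled Y Z = map (0F ∷ᵛ_) Y ++ map (1F ∷ᵛ_) Z

coordSum-doubled-head : (Y Z : Seq (2 + a) m) → coordSum zero (doubled Y Z) ≡ length Z
coordSum-doubled-head Y Z = begin
  coordSum zero (doubled Y Z)                      ≡⟨ coordSum-map-++-map _ _ zero Y Z ⟩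
  sum (map (λ _ → 0) Y) + sum (map (λ _ → 1) Z)  ≡⟨ cong₂ _+_ (sum-map-const 0 Y) (sum-map-const 1 Z) ⟩
  length Y * 0 + length Z * 1                      ≡⟨ cong₂ _+_ (*-zeroʳ (length Y)) (*-identityʳ (length Z)) ⟩
  length Z                                         ∎
  where open ≡-Reasoning

coordSum-doubled-tail : (i : Fin m) (Y Z : Seq (2 + a) m) → coordSum (suc i) (doubled Y Z) ≡ coordSum i (Y ++ Z)
coordSum-doubled-tail i Y Z = trans (coordSum-map-++-map _ _ (suc i) Y Z) (sym (coordSum-++ i Y Z))

cube : (a m : ℕ) → Seq (2 + a) m
cube a zero    = replicate (suc a) []ᵛ
cube a (suc m) = doubled (cube a m) (cube a m)

length-cube : (a m : ℕ) → length (cube a m) ≡ 2 ^ m * suc a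
length-cube a zero    = trans (length-replicate (suc a)) (sym (*-identityˡ (suc a)))
length-cube a (suc m) = begin
  length (doubled (cube a m) (cube a m))  ≡⟨ length-map-++-map _ _ (cube a m) (cube a m) ⟩
  length (cube a m) + length (cube a m)   ≡⟨ cong (λ l → l + l) (length-cube a m) ⟩
  2 ^ m * suc a + 2 ^ m * suc a           ≡⟨ twice (2 ^ m) (suc a) ⟩
  2 ^ suc m * suc a                       ∎
  where
  open ≡-Reasoning
  twice : ∀ P s → P * s + P * s ≡ 2 * P * s
  twice = solve-∀

doubled-¬hasZeroSumOfLength : {X : Seq (2 + a) m} →
  ¬ HasZeroSumOfLength (2 + a) X → ¬ HasZeroSumOfLength (2 + a) (doubled X X)
doubled-¬hasZeroSumOfLength {a} {X = X} X-free (T , T⊆ , |T|≡n , T-zs)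
  with ⊆-map-++-map⁻ (0F ∷ᵛ_) (1F ∷ᵛ_) X X T⊆
... | Y , Z , Y⊆X , Z⊆X , refl = X-free (halves⇒hasZeroSumOfLength Y⊆X Z⊆X halves Y++Z-zs)
  where
  halves : OneIsZeroOtherIs (2 + a) (length Y) (length Z)
  halves = n∣q∧p+q≡n⇒oneIsZeroOtherIs (subst (2 + a ∣_) (coordSum-doubled-head Y Z) (T-zs zero))
                                  (trans (sym (length-map-++-map _ _ Y Z)) |T|≡n)
  Y++Z-zs : IsZeroSum (Y ++ Z)
  Y++Z-zs i = subst (2 + a ∣_) (coordSum-doubled-tail i Y Z) (T-zs (suc i))

cube-¬hasZeroSumOfLength : (a m : ℕ) → ¬ HasZeroSumOfLength (2 + a) (cube a m)
cube-¬hasZeroSumOfLength a zero    = short⇒¬hasZeroSumOfLength (s≤s (≤-reflexive (length-replicate (suc a))))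
cube-¬hasZeroSumOfLength a (suc m) = doubled-¬hasZeroSumOfLength (cube-¬hasZeroSumOfLength a m)

extended : ℕ → Cnr (2 + a) m → Seq (2 + a) m → Seq (2 + a) m → Seq (2 + a) (2 + m)
extended j g Y Z =
  replicate j (1F ∷ᵛ 1F ∷ᵛ g) ++ (map (λ y → 1F ∷ᵛ 0F ∷ᵛ y) Y ++ map (λ z → 0F ∷ᵛ 1F ∷ᵛ z) Z)

length-extended : (j : ℕ) (g : Cnr (2 + a) m) (Y Z : Seq (2 + a) m) →
  length (extended j g Y Z) ≡ j + (length Y + length Z)
length-extended j g Y Z =
  trans (length-++ (replicate j _)) (cong₂ _+_ (length-replicate j) (length-map-++-map _ _ Y Z))

coordSum-extended : (i : Fin (2 + m)) (j : ℕ) (g : Cnr (2 + a) m) (Y Z : Seq (2 + a) m) →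
  coordSum i (extended j g Y Z) ≡ j * toℕ ((1F ∷ᵛ 1F ∷ᵛ g) i)
                                  + (sum (map (λ y → toℕ ((1F ∷ᵛ 0F ∷ᵛ y) i)) Y)
                                     + sum (map (λ z → toℕ ((0F ∷ᵛ 1F ∷ᵛ z) i)) Z))
coordSum-extended i j g Y Z =
  trans (coordSum-++ i (replicate j _) _) (cong₂ _+_ (coordSum-replicate i j _) (coordSum-map-++-map _ _ i Y Z))

coordSum-extended-head : (j : ℕ) (g : Cnr (2 + a) m) (Y Z : Seq (2 + a) m) →
  coordSum zero (extended j g Y Z) ≡ j + length Y × coordSum (suc zero) (extended j g Y Z) ≡ j + length Z
coordSum-extended-head j g Y Z =
  trans (coordSum-extended zero j g Y Z) (trans (cong (j * 1 +_) (counts 1 0)) (first j (length Y) (length Z))) ,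
  trans (coordSum-extended (suc zero) j g Y Z) (trans (cong (j * 1 +_) (counts 0 1)) (second j (length Y) (length Z)))
  where
  counts : ∀ c d → sum (map (λ _ → c) Y) + sum (map (λ _ → d) Z) ≡ length Y * c + length Z * d
  counts c d = cong₂ _+_ (sum-map-const c Y) (sum-map-const d Z)
  first : ∀ j p q → j * 1 + (p * 1 + q * 0) ≡ j + p
  first = solve-∀
  second : ∀ j p q → j * 1 + (p * 0 + q * 1) ≡ j + q
  second = solve-∀

coordSum-extended-tail : (i : Fin m) (j : ℕ) (g : Cnr (2 + a) m) (Y Z : Seq (2 + a) m) →
  coordSum (suc (suc i)) (extended j g Y Z) ≡ j * toℕ (g i) + coordSum i (Y ++ Z)
coordSum-extended-tail i j g Y Z =
  trans (coordSum-extended (suc (suc i)) j g Y Z) (cong (j * toℕ (g i) +_) (sym (coordSum-++ i Y Z)))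

extended-¬hasShortZeroSum : {X : Seq (2 + a) m} (g : Cnr (2 + a) m) → ¬ HasZeroSumOfLength (2 + a) X →
  K + k < 2 * (2 + a) → ¬ HasShortZeroSum K (extended k g X X)
extended-¬hasShortZeroSum {a} {K = K} {k} {X} g X-free K+k<2n (T , T⊆ , 0<|T| , |T|≤K , T-zs)
  with ⊆-replicate-++-map-++-map⁻ k (1F ∷ᵛ 1F ∷ᵛ g) (λ y → 1F ∷ᵛ 0F ∷ᵛ y) (λ z → 0F ∷ᵛ 1F ∷ᵛ z) X T⊆
... | j , Y , Z , j≤k , Y⊆X , Z⊆X , refl
  with n∣j+p∧n∣j+q∧short⇒j≡0∧oneIsZeroOtherIs
         (subst (2 + a ∣_) (proj₁ (coordSum-extended-head j g Y Z)) (T-zs zero))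
         (subst (2 + a ∣_) (proj₂ (coordSum-extended-head j g Y Z)) (T-zs (suc zero)))
         j≤k
         (≤-<-trans (+-monoˡ-≤ k (subst (_≤ K) (length-extended j g Y Z) |T|≤K)) K+k<2n)
         (subst (0 <_) (length-extended j g Y Z) 0<|T|)
... | refl , halves = X-free (halves⇒hasZeroSumOfLength Y⊆X Z⊆X halves Y++Z-zs)
  where
  Y++Z-zs : IsZeroSum (Y ++ Z)
  Y++Z-zs i = subst (2 + a ∣_) (coordSum-extended-tail i 0 g Y Z) (T-zs (suc (suc i)))

length-extended-cube : (k : ℕ) (g : Cnr (2 + a) m) →
  suc (length (extended k g (cube a m) (cube a m))) ≡ 2 ^ suc m * suc a + 1 + k
length-extended-cube {a} {m} k g = begin
  suc (length (extended k g (cube a m) (cube a m)))  ≡⟨ cong suc (length-extended k g (cube a m) (cube a m)) ⟩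
  suc (k + (length (cube a m) + length (cube a m)))  ≡⟨ cong (λ l → suc (k + (l + l))) (length-cube a m) ⟩
  suc (k + (2 ^ m * suc a + 2 ^ m * suc a))          ≡⟨ regroup k (2 ^ m) (suc a) ⟩
  2 ^ suc m * suc a + 1 + k                          ∎
  where
  open ≡-Reasoning
  regroup : ∀ k P s → suc (k + (P * s + P * s)) ≡ 2 * P * s + 1 + k
  regroup = solve-∀

admissible⇒hasShortZeroSum : {S : Seq n r} → Admissible n r K ℓ → ℓ ≤ length S → HasShortZeroSum K S
admissible⇒hasShortZeroSum {ℓ = ℓ} {S} adm ℓ≤|S|
  with adm (take ℓ S) (trans (length-take ℓ S) (m≤n⇒m⊓n≡m ℓ≤|S|))
... | T , T⊆ , short-zs = T , ⊆-trans T⊆ (take-⊆ ℓ S) , short-zs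

¬hasShortZeroSum⇒sLeqGeq : (S : Seq n r) → ¬ HasShortZeroSum K S → sLeqGeq n r K (suc (length S))
¬hasShortZeroSum⇒sLeqGeq S ¬zs ℓ adm = ≰⇒> (λ ℓ≤|S| → ¬zs (admissible⇒hasShortZeroSum adm ℓ≤|S|))

mainTheorem1 : (n r k : ℕ) → 2 ≤ n → 2 ≤ r → k ≤ n ∸ 1 →
    sLeqGeq n r (2 * n ∸ 1 ∸ k) (2 ^ (r ∸ 1) * (n ∸ 1) + 1 + k)
mainTheorem1 (suc (suc a)) (suc (suc m)) k (s≤s (s≤s z≤n)) (s≤s (s≤s z≤n)) k≤n-1 =
  subst (sLeqGeq (2 + a) (2 + m) _) (length-extended-cube k zeroᵛ)
    (¬hasShortZeroSum⇒sLeqGeq (extended k zeroᵛ (cube a m) (cube a m))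
      (extended-¬hasShortZeroSum zeroᵛ (cube-¬hasZeroSumOfLength a m) K+k<2n))
  where
  zeroᵛ : Cnr (2 + a) m
  zeroᵛ _ = 0F
  K+k<2n : 2 * (2 + a) ∸ 1 ∸ k + k < 2 * (2 + a)
  K+k<2n = s≤s (≤-reflexive (m∸n+n≡m (≤-trans k≤n-1 (m≤m+n (suc a) _))))
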